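{- For all $\mathbf d\in\mathbb N^l$ (for any $l\ge1$), $a\in\mathbb N$ and $\mathbf b\in\mathbb N^s$, \[ \sum_{\mathbf 0\le\mathbf r\le\mathbf d}(-1)^{|\mathbf d|+|\mathbf r|}\,\mathrm m_{\mathbf d+\mathbf 1,\mathbf r+\mathbf 1}\sum_{\boldsymbol\alpha\in\mathcal C^s(a+|\mathbf d|-|\mathbf r|)}\mathrm m_{\boldsymbol\alpha,\mathbf b}\,\mu_{a,\boldsymbol\alpha}=\mathrm m_{a,|\mathbf b|-|\mathbf d|}\,\mu_{|\mathbf b|-|\mathbf d|,\mathbf b}. \]
   Context: $\mathbb N=\{1,2,\dots\}$. For tuples, $|\cdot|$ is the sum of entries, $\mathbf 1=(1,\dots,1)$, and $\mathbf r\le\mathbf d$ is componentwise, $\mathbf r\in\mathbb Z_{\ge0}^l$. For $\mathbf k,\mathbf l$ of equal length, $\mathrm m_{\mathbf k,\mathbf l}=(-1)^{|\mathbf k|+|\mathbf l|}\prod_i\binom{k_i-1}{l_i-1}$, where binomial coefficients $\binom nk$ vanish for $k<0$ or $k>n\ge0$; scalars are treated as tuples of length $1$. $\mathcal C^s(n)=\{\boldsymbol\alpha\in\mathbb N^s:|\boldsymbol\alpha|=n\}$. For an integer $t$ and $\boldsymbol\alpha=(\alpha_1,\dots,\alpha_s)$, the threshold indicator is $\mathrm{ind}_t(\boldsymbol\alpha)=\min\{j:\alpha_1+\dots+\alpha_j\ge t\}$, set to $0$ if $\boldsymbol\alpha=\emptyset$ or $t>|\boldsymbol\alpha|$. Let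 $B_k$ be the Bernoulli numbers ($B_1=-\tfrac12$) and $B_1(m,n)=\frac1{m!}\sum_{k=0}^{n-1}\binom mkB_k$ (the coefficients of $\frac{y^2xe^x}{(1-y)(e^{xy}-1)}=\sum B_1(m,n)x^my^n$). The uri multiplicities are $\mu_{t,\boldsymbol\alpha}=B_1(\ell(\boldsymbol\alpha),\mathrm{ind}_t(\boldsymbol\alpha))$, with $\mu_{t,\boldsymbol\alpha}=0$ when $\mathrm{ind}_t(\boldsymbol\alpha)=0$; $\ell(\boldsymbol\alpha)$ is the length. -}

module Defs where

open import Data.Nat as ℕ using (ℕ; zero; suc; _∸_; _!; _+_)
open import Data.Nat.Properties using (_!≢0)
open import Data.Nat.Combinatorics using (_C_)
open import Data.Integer as ℤ using (ℤ; +_; -[1+_]; ∣_∣)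
open import Data.Rational as ℚ using (ℚ; _/_)
open import Data.List as List using (List; []; _∷_; upTo; concatMap; filter; zipWith)
open import Data.Vec as Vec using (Vec; []; _∷_; lookup; toList; _∷ʳ_)
open import Data.Fin using (fromℕ)
open import Relation.Nullary using (yes; no)

∣_∣ᵥ : ∀ {n} → Vec ℕ n → ℕ
∣ v ∣ᵥ = Vec.sum v

_+𝟏 : ∀ {n} → Vec ℕ n → Vec ℕ n
v +𝟏 = Vec.map suc v

ℤ→ℚ : ℤ → ℚ
ℤ→ℚ z = z / 1

signℕ : ℕ → ℚ
signℕ zero    = ℚ.1ℚ
signℕ (suc n) = ℚ.- signℕ n

signℤ : ℤ → ℚ
signℤ x = signℕ ∣ x ∣

Σℚ : List ℚ → ℚ
Σℚ = List.foldr ℚ._+_ ℚ.0ℚ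

Πℚ : List ℚ → ℚ
Πℚ = List.foldr ℚ._*_ ℚ.1ℚ

-- Binomial coefficient binom(n,k) with n ≥ 0 and integer k;
-- vanishes for k < 0 or k > n (stdlib's n C k is 0 for k > n).
binomℤ : ℕ → ℤ → ℕ
binomℤ n (+ k)    = n C k
binomℤ n -[1+ _ ] = 0

-- scalar m_{k,l} = (-1)^{k+l} binom(k-1, l-1), for k ∈ ℕ = {1,2,…}, l ∈ ℤ
mScalar : ℕ → ℤ → ℚ
mScalar k l = signℤ ((+ k) ℤ.+ l) ℚ.* ℤ→ℚ (+ binomℤ (k ∸ 1) (l ℤ.- + 1))

mVec : ∀ {n} → Vec ℕ n → Vec ℕ n → ℚ
mVec k l = signℕ (∣ k ∣ᵥ + ∣ l ∣ᵥ)
  ℚ.* Πℚ (toList (Vec.zipWith (λ kᵢ lᵢ → ℤ→ℚ (+ binomℤ (kᵢ ∸ 1) ((+ lᵢ) ℤ.- + 1))) k l))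

-- Bernoulli numbers (B₁ = -1/2) via B₀ = 1,
-- B_n = -(1/(n+1)) Σ_{k<n} binom(n+1,k) B_k  (n ≥ 1).

nextBernoulli : (n : ℕ) → Vec ℚ n → ℚ
nextBernoulli zero    _  = ℚ.1ℚ
nextBernoulli (suc m) bs =
  ℚ.- ((+ 1 / suc (suc m)) ℚ.*
       Σℚ (zipWith (λ k bk → ℤ→ℚ (+ (suc (suc m) C k)) ℚ.* bk) (upTo (suc m)) (toList bs)))

bernoulliVec : (n : ℕ) → Vec ℚ n
bernoulliVec zero    = []
bernoulliVec (suc n) = bernoulliVec n ∷ʳ nextBernoulli n (bernoulliVec n)

bernoulli : ℕ → ℚ
bernoulli k = lookup (bernoulliVec (suc k)) (fromℕ k)

B₁ : ℕ → ℕ → ℚ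
B₁ m n = ((+ 1 / (m !)) {{m !≢0}})
  ℚ.* Σℚ (List.map (λ k → ℤ→ℚ (+ (m C k)) ℚ.* bernoulli k) (upTo n))

-- threshold indicator ind_t(α) = min{ j ≥ 1 : α₁+…+α_j ≥ t },
-- = 0 if α = ∅ or t > |α|.
ind : ℤ → List ℕ → ℕ
ind t List.[]  = 0
ind t (List._∷_ x xs) with t ℤ.≤? (+ x)
... | yes _ = 1
... | no _ with ind (t ℤ.- (+ x)) xs
...   | zero  = 0
...   | suc j = suc (suc j)

μ : ℤ → List ℕ → ℚ
μ t α with ind t α
... | zero    = ℚ.0ℚ
... | suc j   = B₁ (List.length α) (suc j)

box : ∀ {l} → Vec ℕ l → List (Vec ℕ l)
box []       = [] ∷ []
box (d ∷ ds) = concatMap (λ r → List.map (r ∷_) (box ds)) (upTo (suc d))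

vecsUpTo : (s n : ℕ) → List (Vec ℕ s)
vecsUpTo zero    n = [] ∷ []
vecsUpTo (suc s) n = concatMap (λ k → List.map (suc k ∷_) (vecsUpTo s n)) (upTo n)

-- 𝒞^s(n) = { α ∈ ℕ^s : |α| = n }  (entries ≥ 1, hence ≤ n)
compositions : (s n : ℕ) → List (Vec ℕ s)
compositions s n = filter (λ α → ∣ α ∣ᵥ ℕ.≟ n) (vecsUpTo s n)

-- Every α ∈ 𝒞ˢ(n) has length s, so μ_{a,α} = w (ind_a α) with w = B₁(s, ·); the argument works
-- for an arbitrary weight w. The signed coefficient (-1)^{|d|+|r|} m_{d+1,r+1} is ∏ᵢ C(dᵢ, rᵢ), so
-- the sum over r is (1 + E)^{|d|}, with E the shift n ↦ n + 1, applied to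
-- S(n) = ∑_{α ∈ 𝒞ˢ(n)} m_{α,b} w(ind_a α) at n = a. This is computed by induction on b, splitting
-- off the first part α₁: if α₁ < a, the remaining parts see the threshold a - α₁ and the index
-- shifts by one; if α₁ ≥ a, the index is 1 and the remaining parts contribute m_{n-α₁,|b|-b₁} by
-- the convolution identity ∑_{α ∈ 𝒞ˢ(n)} m_{α,b} = m_{n,|b|}. The Pascal recurrence
-- m_{k,l+1} + m_{k+1,l+1} = m_{k,l} is exactly how 1 + E acts on both pieces.

module Submission where

open import Defs
open import Data.Nat using (ℕ; _+_; _∸_; _≤_)
open import Data.Integer using (+_; _-_)
open import Data.Rational using (_*_)
open import Data.List using (map)
open import Data.Vec using (Vec; lookup; toList)
open import Relation.Binary.PropositionalEquality using (_≡_)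

open import Data.Nat using (zero; suc; _<_; z≤n; s≤s)
import Data.Nat as ℕ
import Data.Nat.Properties as ℕₚ
open import Data.Nat.Combinatorics using (_C_; nCk+nC[k+1]≡[n+1]C[k+1]; k>n⇒nCk≡0)
import Data.Integer as ℤ
import Data.Integer.Properties as ℤₚ
open import Data.Rational as ℚ using (ℚ; 0ℚ; 1ℚ; mkℚ; -_)
import Data.Rational.Properties as ℚₚ
open import Data.Rational.Solver using (module +-*-Solver)
open import Data.Nat.Coprimality using (1-coprimeTo) renaming (sym to coprime-sym)
open import Data.List using (List; []; _∷_; length; upTo; applyUpTo; concatMap; filter; _++_)
open import Data.List.Properties using (map-cong; map-∘)
open import Data.Vec using ([]; _∷_; zipWith)
open import Data.Vec.Relation.Unary.All using (All; []; _∷_)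
open import Data.Vec.Relation.Unary.All.Properties using (lookup⁻)
open import Data.Vec.Properties using (length-toList)
open import Data.Bool using (true; false; if_then_else_)
open import Relation.Nullary using (Dec; does; yes; no; contradiction)
open import Relation.Nullary.Decidable using (dec-true; dec-false)
open import Algebra.Properties.Group ℚₚ.+-0-group
  using () renaming (∙-cancelʳ to +-cancelʳ; ⁻¹-involutive to neg-involutive)
open import Algebra.Properties.CommutativeSemigroup ℕₚ.+-commutativeSemigroup
  using () renaming (interchange to +-interchange)
open import Relation.Binary.PropositionalEquality
  using (refl; sym; trans; cong; cong₂; _≗_; module ≡-Reasoning)

open +-*-Solver
open ≡-Reasoning

ℕ→ℚ : ℕ → ℚ
ℕ→ℚ n = ℤ→ℚ (+ n)

ℕ→ℚ≡mkℚ : ∀ n → ℕ→ℚ n ≡ mkℚ (+ n) 0 (coprime-sym (1-coprimeTo n))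
ℕ→ℚ≡mkℚ n = ℚₚ.normalize-coprime (coprime-sym (1-coprimeTo n))

ℕ→ℚ-homo-+ : ∀ m n → ℕ→ℚ (m + n) ≡ ℕ→ℚ m ℚ.+ ℕ→ℚ n
ℕ→ℚ-homo-+ m n rewrite ℕ→ℚ≡mkℚ m | ℕ→ℚ≡mkℚ n =
  cong (ℚ._/ 1) (sym (cong₂ ℤ._+_ (ℤₚ.*-identityʳ (+ m)) (ℤₚ.*-identityʳ (+ n))))

signℕ-+ : ∀ m n → signℕ (m + n) ≡ signℕ m * signℕ n
signℕ-+ zero    n = sym (ℚₚ.*-identityˡ (signℕ n))
signℕ-+ (suc m) n = trans (cong -_ (signℕ-+ m n)) (ℚₚ.neg-distribˡ-* (signℕ m) (signℕ n))

signℕ-square : ∀ n → signℕ n * signℕ n ≡ 1ℚ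
signℕ-square zero    = refl
signℕ-square (suc n) =
  trans (solve 1 (λ s → (:- s) :* (:- s) := s :* s) refl (signℕ n)) (signℕ-square n)

sumTo : ℕ → (ℕ → ℚ) → ℚ
sumTo zero    f = 0ℚ
sumTo (suc n) f = f 0 ℚ.+ sumTo n (λ i → f (suc i))

sumTo-cong : ∀ n {f g : ℕ → ℚ} → (∀ i → i < n → f i ≡ g i) → sumTo n f ≡ sumTo n g
sumTo-cong zero    f≡g = refl
sumTo-cong (suc n) f≡g =
  cong₂ ℚ._+_ (f≡g 0 (s≤s z≤n)) (sumTo-cong n (λ i i<n → f≡g (suc i) (s≤s i<n)))

sumTo-cong-≗ : ∀ n {f g : ℕ → ℚ} → f ≗ g → sumTo n f ≡ sumTo n g
sumTo-cong-≗ n f≗g = sumTo-cong n (λ i _ → f≗g i)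

sumTo-zero : ∀ n {f : ℕ → ℚ} → (∀ i → i < n → f i ≡ 0ℚ) → sumTo n f ≡ 0ℚ
sumTo-zero zero    f≡0 = refl
sumTo-zero (suc n) f≡0 =
  trans (cong₂ ℚ._+_ (f≡0 0 (s≤s z≤n)) (sumTo-zero n (λ i i<n → f≡0 (suc i) (s≤s i<n))))
        (ℚₚ.+-identityˡ 0ℚ)

sumTo-distrib-+ : ∀ n (f g : ℕ → ℚ) → sumTo n (λ i → f i ℚ.+ g i) ≡ sumTo n f ℚ.+ sumTo n g
sumTo-distrib-+ zero    f g = refl
sumTo-distrib-+ (suc n) f g =
  trans (cong ((f 0 ℚ.+ g 0) ℚ.+_) (sumTo-distrib-+ n (λ i → f (suc i)) (λ i → g (suc i))))
        (solve 4 (λ a b c d → (a :+ b) :+ (c :+ d) := (a :+ c) :+ (b :+ d)) refl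
               (f 0) (g 0) (sumTo n (λ i → f (suc i))) (sumTo n (λ i → g (suc i))))

*-distribˡ-sumTo : ∀ n c (f : ℕ → ℚ) → sumTo n (λ i → c * f i) ≡ c * sumTo n f
*-distribˡ-sumTo zero    c f = sym (ℚₚ.*-zeroʳ c)
*-distribˡ-sumTo (suc n) c f =
  trans (cong (c * f 0 ℚ.+_) (*-distribˡ-sumTo n c (λ i → f (suc i))))
        (sym (ℚₚ.*-distribˡ-+ c (f 0) _))

sumTo-+ : ∀ m n (f : ℕ → ℚ) → sumTo (m + n) f ≡ sumTo m f ℚ.+ sumTo n (λ i → f (m + i))
sumTo-+ zero    n f = sym (ℚₚ.+-identityˡ _)
sumTo-+ (suc m) n f = trans (cong (f 0 ℚ.+_) (sumTo-+ m n (λ i → f (suc i))))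
                            (sym (ℚₚ.+-assoc (f 0) _ _))

sumTo-last : ∀ n (f : ℕ → ℚ) → sumTo (suc n) f ≡ sumTo n f ℚ.+ f n
sumTo-last zero    f = trans (ℚₚ.+-identityʳ (f 0)) (sym (ℚₚ.+-identityˡ (f 0)))
sumTo-last (suc n) f = trans (cong (f 0 ℚ.+_) (sumTo-last n (λ i → f (suc i))))
                             (sym (ℚₚ.+-assoc (f 0) _ _))

sumTo-dropLast : ∀ n (f : ℕ → ℚ) → f n ≡ 0ℚ → sumTo (suc n) f ≡ sumTo n f
sumTo-dropLast n f fn≡0 =
  trans (sumTo-last n f) (trans (cong (sumTo n f ℚ.+_) fn≡0) (ℚₚ.+-identityʳ _))

Σℚ-map-cong : ∀ {A : Set} (xs : List A) {f g : A → ℚ} → f ≗ g →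
              Σℚ (map f xs) ≡ Σℚ (map g xs)
Σℚ-map-cong xs f≗g = cong Σℚ (map-cong f≗g xs)

Σℚ-zero : ∀ {A : Set} (xs : List A) {f : A → ℚ} → (∀ x → f x ≡ 0ℚ) →
          Σℚ (map f xs) ≡ 0ℚ
Σℚ-zero []       f≡0 = refl
Σℚ-zero (x ∷ xs) f≡0 = trans (cong₂ ℚ._+_ (f≡0 x) (Σℚ-zero xs f≡0)) (ℚₚ.+-identityˡ 0ℚ)

*-distribˡ-Σℚ : ∀ {A : Set} (xs : List A) c (f : A → ℚ) →
                Σℚ (map (λ x → c * f x) xs) ≡ c * Σℚ (map f xs)
*-distribˡ-Σℚ []       c f = sym (ℚₚ.*-zeroʳ c)
*-distribˡ-Σℚ (x ∷ xs) c f = trans (cong (c * f x ℚ.+_) (*-distribˡ-Σℚ xs c f))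
                                   (sym (ℚₚ.*-distribˡ-+ c (f x) _))

Σℚ-++ : ∀ {A : Set} (xs ys : List A) (f : A → ℚ) →
        Σℚ (map f (xs ++ ys)) ≡ Σℚ (map f xs) ℚ.+ Σℚ (map f ys)
Σℚ-++ []       ys f = sym (ℚₚ.+-identityˡ _)
Σℚ-++ (x ∷ xs) ys f = trans (cong (f x ℚ.+_) (Σℚ-++ xs ys f)) (sym (ℚₚ.+-assoc (f x) _ _))

Σℚ-applyUpTo : ∀ n (g : ℕ → ℕ) (f : ℕ → ℚ) →
               Σℚ (map f (applyUpTo g n)) ≡ sumTo n (λ i → f (g i))
Σℚ-applyUpTo zero    g f = refl
Σℚ-applyUpTo (suc n) g f = cong (f (g 0) ℚ.+_) (Σℚ-applyUpTo n (λ i → g (suc i)) f)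

Σℚ-filter : ∀ {A : Set} {P : A → Set} (P? : ∀ x → Dec (P x)) (xs : List A) (f : A → ℚ) →
            Σℚ (map f (filter P? xs)) ≡ Σℚ (map (λ x → if does (P? x) then f x else 0ℚ) xs)
Σℚ-filter P? []       f = refl
Σℚ-filter P? (x ∷ xs) f with does (P? x)
... | true  = cong (f x ℚ.+_) (Σℚ-filter P? xs f)
... | false = trans (Σℚ-filter P? xs f) (sym (ℚₚ.+-identityˡ _))

Σℚ-concatMap-upTo : ∀ {A B : Set} n (g : ℕ → A → B) (xs : List A) (f : B → ℚ) →
                    Σℚ (map f (concatMap (λ i → map (g i) xs) (upTo n)))
                    ≡ sumTo n (λ i → Σℚ (map (λ x → f (g i x)) xs))
Σℚ-concatMap-upTo n g xs f = trans (Σℚ-concatMap (upTo n)) (Σℚ-applyUpTo n (λ i → i) _)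
  where
  Σℚ-concatMap : ∀ is → Σℚ (map f (concatMap (λ i → map (g i) xs) is))
                        ≡ Σℚ (map (λ i → Σℚ (map (λ x → f (g i x)) xs)) is)
  Σℚ-concatMap []       = refl
  Σℚ-concatMap (i ∷ is) = trans (Σℚ-++ (map (g i) xs) _ f)
                                (cong₂ ℚ._+_ (cong Σℚ (sym (map-∘ xs))) (Σℚ-concatMap is))

-- shiftSum D F = (1 + E)ᴰ F, where E is the shift E F n = F (n + 1).
shiftSum : ℕ → (ℕ → ℚ) → ℕ → ℚ
shiftSum zero    F n = F n
shiftSum (suc D) F n = shiftSum D F n ℚ.+ shiftSum D F (suc n)

shiftSum-cong : ∀ D {F G : ℕ → ℚ} → F ≗ G → shiftSum D F ≗ shiftSum D G
shiftSum-cong zero    F≗G n = F≗G n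
shiftSum-cong (suc D) F≗G n = cong₂ ℚ._+_ (shiftSum-cong D F≗G n) (shiftSum-cong D F≗G (suc n))

shiftSum-zero : ∀ D n → shiftSum D (λ _ → 0ℚ) n ≡ 0ℚ
shiftSum-zero zero    n = refl
shiftSum-zero (suc D) n = cong₂ ℚ._+_ (shiftSum-zero D n) (shiftSum-zero D (suc n))

shiftSum-distrib-+ : ∀ D (F G : ℕ → ℚ) n →
                     shiftSum D (λ m → F m ℚ.+ G m) n ≡ shiftSum D F n ℚ.+ shiftSum D G n
shiftSum-distrib-+ zero    F G n = refl
shiftSum-distrib-+ (suc D) F G n =
  trans (cong₂ ℚ._+_ (shiftSum-distrib-+ D F G n) (shiftSum-distrib-+ D F G (suc n)))
        (solve 4 (λ a b c d → (a :+ b) :+ (c :+ d) := (a :+ c) :+ (b :+ d)) refl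
                (shiftSum D F n) (shiftSum D G n) (shiftSum D F (suc n)) (shiftSum D G (suc n)))

*-distribˡ-shiftSum : ∀ D c (F : ℕ → ℚ) n → shiftSum D (λ m → c * F m) n ≡ c * shiftSum D F n
*-distribˡ-shiftSum zero    c F n = refl
*-distribˡ-shiftSum (suc D) c F n =
  trans (cong₂ ℚ._+_ (*-distribˡ-shiftSum D c F n) (*-distribˡ-shiftSum D c F (suc n)))
        (sym (ℚₚ.*-distribˡ-+ c _ _))

shiftSum-sumTo : ∀ D k (F : ℕ → ℕ → ℚ) n →
                 shiftSum D (λ m → sumTo k (λ i → F i m)) n ≡ sumTo k (λ i → shiftSum D (F i) n)
shiftSum-sumTo D zero    F n = shiftSum-zero D n
shiftSum-sumTo D (suc k) F n =
  trans (shiftSum-distrib-+ D (F 0) (λ m → sumTo k (λ i → F (suc i) m)) n)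
        (cong (shiftSum D (F 0) n ℚ.+_) (shiftSum-sumTo D k (λ i → F (suc i)) n))

shiftSum-suc : ∀ D {F G : ℕ → ℚ} → (∀ m → F m ℚ.+ F (suc m) ≡ G m) →
               shiftSum (suc D) F ≗ shiftSum D G
shiftSum-suc zero    F+EF≡G n = F+EF≡G n
shiftSum-suc (suc D) F+EF≡G n =
  cong₂ ℚ._+_ (shiftSum-suc D F+EF≡G n) (shiftSum-suc D F+EF≡G (suc n))

shiftSum-shiftSum : ∀ D D′ (F : ℕ → ℚ) → shiftSum D (shiftSum D′ F) ≗ shiftSum (D + D′) F
shiftSum-shiftSum zero    D′ F n = refl
shiftSum-shiftSum (suc D) D′ F n =
  cong₂ ℚ._+_ (shiftSum-shiftSum D D′ F n) (shiftSum-shiftSum D D′ F (suc n))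

shiftSum-translate : ∀ D (F : ℕ → ℚ) c n →
                     shiftSum D (λ m → F (c + m)) n ≡ shiftSum D F (c + n)
shiftSum-translate zero    F c n = refl
shiftSum-translate (suc D) F c n =
  cong₂ ℚ._+_ (shiftSum-translate D F c n)
              (trans (shiftSum-translate D F c (suc n)) (cong (shiftSum D F) (ℕₚ.+-suc c n)))

shiftSum-binomial : ∀ D (F : ℕ → ℚ) n →
                    sumTo (suc D) (λ r → ℕ→ℚ (D C r) * F (n + (D ∸ r))) ≡ shiftSum D F n
shiftSum-binomial zero    F n =
  trans (ℚₚ.+-identityʳ _) (trans (ℚₚ.*-identityˡ _) (cong F (ℕₚ.+-identityʳ n)))
shiftSum-binomial (suc D) F n = begin
  1ℚ * F (n + suc D) ℚ.+ sumTo (suc D) (λ r → ℕ→ℚ (suc D C suc r) * F (n + (D ∸ r)))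
    ≡⟨ cong₂ ℚ._+_ (trans (ℚₚ.*-identityˡ _) (cong F (ℕₚ.+-suc n D)))
                   (trans (sumTo-cong-≗ (suc D) pascal) (sumTo-distrib-+ (suc D) lower upper)) ⟩
  F (suc n + D) ℚ.+ (sumTo (suc D) lower ℚ.+ sumTo (suc D) upper)
    ≡⟨ solve 3 (λ x y z → x :+ (y :+ z) := y :+ (x :+ z)) refl
         (F (suc n + D)) (sumTo (suc D) lower) (sumTo (suc D) upper) ⟩
  sumTo (suc D) lower ℚ.+ (F (suc n + D) ℚ.+ sumTo (suc D) upper)
    ≡⟨ cong (sumTo (suc D) lower ℚ.+_)
            (cong₂ ℚ._+_ (sym (ℚₚ.*-identityˡ (F (suc n + D))))
                         (trans (sumTo-dropLast D upper upper-last) (sumTo-cong D upper-reindex))) ⟩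
  sumTo (suc D) lower ℚ.+ sumTo (suc D) (λ r → ℕ→ℚ (D C r) * F (suc n + (D ∸ r)))
    ≡⟨ cong₂ ℚ._+_ (shiftSum-binomial D F n) (shiftSum-binomial D F (suc n)) ⟩
  shiftSum D F n ℚ.+ shiftSum D F (suc n) ∎
  where
  lower upper : ℕ → ℚ
  lower r = ℕ→ℚ (D C r) * F (n + (D ∸ r))
  upper r = ℕ→ℚ (D C suc r) * F (n + (D ∸ r))

  pascal : ∀ r → ℕ→ℚ (suc D C suc r) * F (n + (D ∸ r)) ≡ lower r ℚ.+ upper r
  pascal r = begin
    ℕ→ℚ (suc D C suc r) * F (n + (D ∸ r))
      ≡⟨ cong (λ c → ℕ→ℚ c * F (n + (D ∸ r))) (sym (nCk+nC[k+1]≡[n+1]C[k+1] D r)) ⟩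
    ℕ→ℚ (D C r + D C suc r) * F (n + (D ∸ r))
      ≡⟨ cong (_* F (n + (D ∸ r))) (ℕ→ℚ-homo-+ (D C r) (D C suc r)) ⟩
    (ℕ→ℚ (D C r) ℚ.+ ℕ→ℚ (D C suc r)) * F (n + (D ∸ r))
      ≡⟨ ℚₚ.*-distribʳ-+ (F (n + (D ∸ r))) (ℕ→ℚ (D C r)) (ℕ→ℚ (D C suc r)) ⟩
    lower r ℚ.+ upper r ∎

  upper-last : upper D ≡ 0ℚ
  upper-last = trans (cong (λ c → ℕ→ℚ c * F (n + (D ∸ D))) (k>n⇒nCk≡0 (ℕₚ.n<1+n D)))
                     (ℚₚ.*-zeroˡ (F (n + (D ∸ D))))

  upper-reindex : ∀ r → r < D → upper r ≡ ℕ→ℚ (D C suc r) * F (suc n + (D ∸ suc r))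
  upper-reindex r r<D = cong (λ m → ℕ→ℚ (D C suc r) * F m)
    (trans (cong (λ m → n + m) (ℕₚ.+-∸-assoc 1 r<D)) (ℕₚ.+-suc n (D ∸ suc r)))

-- mℕ k l = m_{k,l} for k, l ≥ 1, extended by m_{0,0} = 1 and 0 elsewhere; it is the coefficient
-- of yᵏ in (y/(1+y))ˡ, which is where the convolution identity mℕ-convolution comes from.
mℕ : ℕ → ℕ → ℚ
mℕ zero    zero    = 1ℚ
mℕ zero    (suc l) = 0ℚ
mℕ (suc k) zero    = 0ℚ
mℕ (suc k) (suc l) = signℕ (k + l) * ℕ→ℚ (k C l)

mVec-∷ : ∀ {s} k l (ks ls : Vec ℕ s) →
         mVec (suc k ∷ ks) (suc l ∷ ls) ≡ mℕ (suc k) (suc l) * mVec ks ls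
mVec-∷ k l ks ls = begin
  signℕ ((suc k + K) + (suc l + L)) * (ℕ→ℚ (k C l) * Π)
    ≡⟨ cong (λ m → signℕ m * (ℕ→ℚ (k C l) * Π))
         (trans (+-interchange (suc k) K (suc l) L) (cong (λ m → suc m + (K + L)) (ℕₚ.+-suc k l))) ⟩
  - - signℕ ((k + l) + (K + L)) * (ℕ→ℚ (k C l) * Π)
    ≡⟨ cong (λ σ → - - σ * (ℕ→ℚ (k C l) * Π)) (signℕ-+ (k + l) (K + L)) ⟩
  - - (signℕ (k + l) * signℕ (K + L)) * (ℕ→ℚ (k C l) * Π)
    ≡⟨ solve 4 (λ s σ c π → (:- (:- (s :* σ))) :* (c :* π) := (s :* c) :* (σ :* π)) refl
         (signℕ (k + l)) (signℕ (K + L)) (ℕ→ℚ (k C l)) Π ⟩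
  mℕ (suc k) (suc l) * mVec ks ls ∎
  where
  K = ∣ ks ∣ᵥ
  L = ∣ ls ∣ᵥ
  Π = Πℚ (toList (zipWith (λ kᵢ lᵢ → ℤ→ℚ (+ binomℤ (kᵢ ∸ 1) (+ lᵢ - + 1))) ks ls))

binomials : ∀ {l} → Vec ℕ l → Vec ℕ l → ℚ
binomials []       []       = 1ℚ
binomials (d ∷ ds) (r ∷ rs) = ℕ→ℚ (d C r) * binomials ds rs

signed-mVec-+𝟏 : ∀ {l} (d r : Vec ℕ l) →
                 signℕ (∣ d ∣ᵥ + ∣ r ∣ᵥ) * mVec (d +𝟏) (r +𝟏) ≡ binomials d r
signed-mVec-+𝟏 []       []       = refl
signed-mVec-+𝟏 (d ∷ ds) (r ∷ rs) = begin
  signℕ ((d + D) + (r + R)) * mVec (suc d ∷ ds +𝟏) (suc r ∷ rs +𝟏)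
    ≡⟨ cong₂ _*_ (trans (cong signℕ (+-interchange d D r R)) (signℕ-+ (d + r) (D + R)))
                 (mVec-∷ d r (ds +𝟏) (rs +𝟏)) ⟩
  (signℕ (d + r) * signℕ (D + R)) * ((signℕ (d + r) * ℕ→ℚ (d C r)) * mVec (ds +𝟏) (rs +𝟏))
    ≡⟨ solve 4 (λ s σ c m → (s :* σ) :* ((s :* c) :* m) := (s :* s) :* (c :* (σ :* m))) refl
         (signℕ (d + r)) (signℕ (D + R)) (ℕ→ℚ (d C r)) (mVec (ds +𝟏) (rs +𝟏)) ⟩
  (signℕ (d + r) * signℕ (d + r)) * (ℕ→ℚ (d C r) * (signℕ (D + R) * mVec (ds +𝟏) (rs +𝟏)))
    ≡⟨ cong₂ _*_ (signℕ-square (d + r)) (cong (ℕ→ℚ (d C r) *_) (signed-mVec-+𝟏 ds rs)) ⟩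
  1ℚ * binomials (d ∷ ds) (r ∷ rs)
    ≡⟨ ℚₚ.*-identityˡ _ ⟩
  binomials (d ∷ ds) (r ∷ rs) ∎
  where
  D = ∣ ds ∣ᵥ
  R = ∣ rs ∣ᵥ

[m+n]∸[o+p]≡[m∸o]+[n∸p] : ∀ m n {o p} → o ≤ m → p ≤ n →
                          (m + n) ∸ (o + p) ≡ (m ∸ o) + (n ∸ p)
[m+n]∸[o+p]≡[m∸o]+[n∸p] m n {o} {p} o≤m p≤n = begin
  (m + n) ∸ (o + p)   ≡⟨ sym (ℕₚ.∸-+-assoc (m + n) o p) ⟩
  (m + n) ∸ o ∸ p     ≡⟨ cong (_∸ p) (ℕₚ.+-∸-comm n o≤m) ⟩
  (m ∸ o) + n ∸ p     ≡⟨ ℕₚ.+-∸-assoc (m ∸ o) p≤n ⟩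
  (m ∸ o) + (n ∸ p)   ∎

Σℚ-box-cong : ∀ {l} (d : Vec ℕ l) {f g : Vec ℕ l → ℚ} →
              (∀ r → ∣ r ∣ᵥ ≤ ∣ d ∣ᵥ → f r ≡ g r) →
              Σℚ (map f (box d)) ≡ Σℚ (map g (box d))
Σℚ-box-cong []       f≡g = cong (ℚ._+ 0ℚ) (f≡g [] z≤n)
Σℚ-box-cong (d ∷ ds) {f} {g} f≡g = begin
  Σℚ (map f (box (d ∷ ds)))
    ≡⟨ Σℚ-concatMap-upTo (suc d) _∷_ (box ds) f ⟩
  sumTo (suc d) (λ r → Σℚ (map (λ rs → f (r ∷ rs)) (box ds)))
    ≡⟨ sumTo-cong (suc d) (λ r r≤d → Σℚ-box-cong ds (λ rs rs≤ds →
         f≡g (r ∷ rs) (ℕₚ.+-mono-≤ (ℕₚ.≤-pred r≤d) rs≤ds))) ⟩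
  sumTo (suc d) (λ r → Σℚ (map (λ rs → g (r ∷ rs)) (box ds)))
    ≡⟨ sym (Σℚ-concatMap-upTo (suc d) _∷_ (box ds) g) ⟩
  Σℚ (map g (box (d ∷ ds))) ∎

Σℚ-box-binomials : ∀ {l} (d : Vec ℕ l) (F : ℕ → ℚ) n →
                   Σℚ (map (λ r → binomials d r * F (n + (∣ d ∣ᵥ ∸ ∣ r ∣ᵥ))) (box d))
                   ≡ shiftSum ∣ d ∣ᵥ F n
Σℚ-box-binomials []       F n =
  trans (ℚₚ.+-identityʳ _) (trans (ℚₚ.*-identityˡ _) (cong F (ℕₚ.+-identityʳ n)))
Σℚ-box-binomials (d ∷ ds) F n = begin
  Σℚ (map (λ r → binomials (d ∷ ds) r * F (n + (d + D ∸ ∣ r ∣ᵥ))) (box (d ∷ ds)))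
    ≡⟨ Σℚ-concatMap-upTo (suc d) _∷_ (box ds) _ ⟩
  sumTo (suc d) (λ r → Σℚ (map (summand r) (box ds)))
    ≡⟨ sumTo-cong (suc d) (λ r r<1+d → inner r (ℕₚ.≤-pred r<1+d)) ⟩
  sumTo (suc d) (λ r → ℕ→ℚ (d C r) * shiftSum D F (n + (d ∸ r)))
    ≡⟨ shiftSum-binomial d (shiftSum D F) n ⟩
  shiftSum d (shiftSum D F) n
    ≡⟨ shiftSum-shiftSum d D F n ⟩
  shiftSum (d + D) F n ∎
  where
  D = ∣ ds ∣ᵥ
  summand : ℕ → Vec ℕ _ → ℚ
  summand r rs = ℕ→ℚ (d C r) * binomials ds rs * F (n + (d + D ∸ (r + ∣ rs ∣ᵥ)))
  inner : ∀ r → r ≤ d → Σℚ (map (summand r) (box ds)) ≡ ℕ→ℚ (d C r) * shiftSum D F (n + (d ∸ r))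
  inner r r≤d = begin
    Σℚ (map (summand r) (box ds))
      ≡⟨ Σℚ-box-cong ds (λ rs rs≤ds →
           trans (ℚₚ.*-assoc (ℕ→ℚ (d C r)) (binomials ds rs) _)
                 (cong (λ m → ℕ→ℚ (d C r) * (binomials ds rs * F m)) (split rs rs≤ds))) ⟩
    Σℚ (map (λ rs → ℕ→ℚ (d C r) * G rs) (box ds))
      ≡⟨ *-distribˡ-Σℚ (box ds) (ℕ→ℚ (d C r)) G ⟩
    ℕ→ℚ (d C r) * Σℚ (map G (box ds))
      ≡⟨ cong (ℕ→ℚ (d C r) *_) (Σℚ-box-binomials ds F (n + (d ∸ r))) ⟩
    ℕ→ℚ (d C r) * shiftSum D F (n + (d ∸ r)) ∎
    where
    G : Vec ℕ _ → ℚ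
    G rs = binomials ds rs * F (n + (d ∸ r) + (D ∸ ∣ rs ∣ᵥ))
    split : ∀ (rs : Vec ℕ _) → ∣ rs ∣ᵥ ≤ D →
            n + (d + D ∸ (r + ∣ rs ∣ᵥ)) ≡ n + (d ∸ r) + (D ∸ ∣ rs ∣ᵥ)
    split rs rs≤ds = trans (cong (λ m → n + m) ([m+n]∸[o+p]≡[m∸o]+[n∸p] d D r≤d rs≤ds))
                             (sym (ℕₚ.+-assoc n (d ∸ r) (D ∸ ∣ rs ∣ᵥ)))

compositionSum : (s n : ℕ) → (Vec ℕ s → ℚ) → ℚ
compositionSum zero    zero    f = f []
compositionSum zero    (suc n) f = 0ℚ
compositionSum (suc s) n       f =
  sumTo n (λ x → compositionSum s (n ∸ suc x) (λ α → f (suc x ∷ α)))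

compositionSum-cong : ∀ s n {f g : Vec ℕ s → ℚ} → f ≗ g →
                      compositionSum s n f ≡ compositionSum s n g
compositionSum-cong zero    zero    f≗g = f≗g []
compositionSum-cong zero    (suc n) f≗g = refl
compositionSum-cong (suc s) n       f≗g =
  sumTo-cong-≗ n (λ x → compositionSum-cong s (n ∸ suc x) (λ α → f≗g (suc x ∷ α)))

*-distribˡ-compositionSum : ∀ s n c (f : Vec ℕ s → ℚ) →
                            compositionSum s n (λ α → c * f α) ≡ c * compositionSum s n f
*-distribˡ-compositionSum zero    zero    c f = refl
*-distribˡ-compositionSum zero    (suc n) c f = sym (ℚₚ.*-zeroʳ c)
*-distribˡ-compositionSum (suc s) n       c f =
  trans (sumTo-cong-≗ n (λ x → *-distribˡ-compositionSum s (n ∸ suc x) c (λ α → f (suc x ∷ α))))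
        (*-distribˡ-sumTo n c _)

does-≡ : ∀ {P R : Set} (P? : Dec P) (R? : Dec R) → (P → R) → (R → P) → does P? ≡ does R?
does-≡ P? (yes r) P→R R→P = dec-true P? (R→P r)
does-≡ P? (no ¬r) P→R R→P = dec-false P? (λ p → ¬r (P→R p))

Σℚ-vecsUpTo-sized : ∀ s N m (f : Vec ℕ s → ℚ) → m ≤ N →
                    Σℚ (map (λ α → if does (∣ α ∣ᵥ ℕ.≟ m) then f α else 0ℚ) (vecsUpTo s N))
                    ≡ compositionSum s m f
Σℚ-vecsUpTo-sized zero    N zero    f m≤N = ℚₚ.+-identityʳ (f [])
Σℚ-vecsUpTo-sized zero    N (suc m) f m≤N = refl
Σℚ-vecsUpTo-sized (suc s) N m       f m≤N = begin
  Σℚ (map (λ α → if does (∣ α ∣ᵥ ℕ.≟ m) then f α else 0ℚ) (vecsUpTo (suc s) N))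
    ≡⟨ Σℚ-concatMap-upTo N (λ x → suc x ∷_) (vecsUpTo s N) _ ⟩
  sumTo N T
    ≡⟨ cong (λ n → sumTo n T) (sym (ℕₚ.m+[n∸m]≡n m≤N)) ⟩
  sumTo (m + (N ∸ m)) T
    ≡⟨ sumTo-+ m (N ∸ m) T ⟩
  sumTo m T ℚ.+ sumTo (N ∸ m) (λ i → T (m + i))
    ≡⟨ cong₂ ℚ._+_ (sumTo-cong m first-part<m) (sumTo-zero (N ∸ m) (λ i _ → first-part≥m i)) ⟩
  compositionSum (suc s) m f ℚ.+ 0ℚ
    ≡⟨ ℚₚ.+-identityʳ _ ⟩
  compositionSum (suc s) m f ∎
  where
  T : ℕ → ℚ
  T x = Σℚ (map (λ α → if does (suc x + ∣ α ∣ᵥ ℕ.≟ m) then f (suc x ∷ α) else 0ℚ)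
                (vecsUpTo s N))
  first-part<m : ∀ x → x < m → T x ≡ compositionSum s (m ∸ suc x) (λ α → f (suc x ∷ α))
  first-part<m x x<m = trans
    (Σℚ-map-cong (vecsUpTo s N) (λ α → cong (λ b → if b then f (suc x ∷ α) else 0ℚ)
      (does-≡ (suc x + ∣ α ∣ᵥ ℕ.≟ m) (∣ α ∣ᵥ ℕ.≟ m ∸ suc x)
              (λ eq → trans (sym (ℕₚ.m+n∸m≡n (suc x) ∣ α ∣ᵥ)) (cong (_∸ suc x) eq))
              (λ eq → trans (cong (λ n → suc x + n) eq) (ℕₚ.m+[n∸m]≡n x<m)))))
    (Σℚ-vecsUpTo-sized s N (m ∸ suc x) _ (ℕₚ.≤-trans (ℕₚ.m∸n≤m m (suc x)) m≤N))
  first-part≥m : ∀ i → T (m + i) ≡ 0ℚ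
  first-part≥m i = Σℚ-zero (vecsUpTo s N) (λ α →
    cong (λ b → if b then f (suc (m + i) ∷ α) else 0ℚ)
         (dec-false (suc (m + i) + ∣ α ∣ᵥ ℕ.≟ m) (λ eq → ℕₚ.<⇒≢ (m<1+m+i+|α| α) (sym eq))))
    where
    m<1+m+i+|α| : ∀ (α : Vec ℕ s) → m < suc (m + i) + ∣ α ∣ᵥ
    m<1+m+i+|α| α = s≤s (ℕₚ.≤-trans (ℕₚ.m≤m+n m i) (ℕₚ.m≤m+n (m + i) ∣ α ∣ᵥ))

Σℚ-compositions : ∀ s n (f : Vec ℕ s → ℚ) →
                  Σℚ (map f (compositions s n)) ≡ compositionSum s n f
Σℚ-compositions s n f = trans (Σℚ-filter (λ α → ∣ α ∣ᵥ ℕ.≟ n) (vecsUpTo s n) f)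
                              (Σℚ-vecsUpTo-sized s n n f ℕₚ.≤-refl)

mℕ-pascal : ∀ k l → mℕ k (suc l) ℚ.+ mℕ (suc k) (suc l) ≡ mℕ k l
mℕ-pascal zero    zero    = refl
mℕ-pascal zero    (suc l) = trans (ℚₚ.+-identityˡ _) (ℚₚ.*-zeroʳ (signℕ (suc l)))
mℕ-pascal (suc k) zero    =
  solve 1 (λ s → s :* con 1ℚ :+ (:- s) :* con 1ℚ := con 0ℚ) refl (signℕ (k + 0))
mℕ-pascal (suc k) (suc l) = begin
  signℕ (k + suc l) * ℕ→ℚ (k C suc l) ℚ.+ signℕ (suc k + suc l) * ℕ→ℚ (suc k C suc l)
    ≡⟨ cong₂ (λ σ c → σ * ℕ→ℚ (k C suc l) ℚ.+ - σ * c) (cong signℕ (ℕₚ.+-suc k l))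
         (trans (cong ℕ→ℚ (sym (nCk+nC[k+1]≡[n+1]C[k+1] k l)))
                (ℕ→ℚ-homo-+ (k C l) (k C suc l))) ⟩
  - σ * B ℚ.+ - - σ * (A ℚ.+ B)
    ≡⟨ solve 3 (λ σ A B → (:- σ) :* B :+ (:- (:- σ)) :* (A :+ B) := σ :* A) refl σ A B ⟩
  σ * A ∎
  where
  σ = signℕ (k + l)
  A = ℕ→ℚ (k C l)
  B = ℕ→ℚ (k C suc l)

convolution : ℕ → ℕ → ℕ → ℚ
convolution p q n = sumTo (suc n) (λ x → mℕ x p * mℕ (n ∸ x) q)

convolution-pascal : ∀ p q n →
                     convolution (suc p) q (suc n) ℚ.+ convolution (suc p) q n ≡ convolution p q n
convolution-pascal p q n = begin
  0ℚ * mℕ (suc n) q ℚ.+ sumTo (suc n) next ℚ.+ sumTo (suc n) here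
    ≡⟨ cong (ℚ._+ sumTo (suc n) here)
            (trans (cong (ℚ._+ sumTo (suc n) next) (ℚₚ.*-zeroˡ (mℕ (suc n) q)))
                   (ℚₚ.+-identityˡ (sumTo (suc n) next))) ⟩
  sumTo (suc n) next ℚ.+ sumTo (suc n) here
    ≡⟨ sym (sumTo-distrib-+ (suc n) next here) ⟩
  sumTo (suc n) (λ x → next x ℚ.+ here x)
    ≡⟨ sumTo-cong-≗ (suc n) (λ x →
         trans (sym (ℚₚ.*-distribʳ-+ (mℕ (n ∸ x) q) (mℕ (suc x) (suc p)) (mℕ x (suc p))))
               (cong (_* mℕ (n ∸ x) q) (trans (ℚₚ.+-comm (mℕ (suc x) (suc p)) (mℕ x (suc p)))
                                              (mℕ-pascal x p)))) ⟩
  convolution p q n ∎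
  where
  next here : ℕ → ℚ
  next x = mℕ (suc x) (suc p) * mℕ (n ∸ x) q
  here x = mℕ x (suc p) * mℕ (n ∸ x) q

mℕ-convolution : ∀ n p q → convolution p q n ≡ mℕ n (p + q)
mℕ-convolution zero    zero    zero    = refl
mℕ-convolution zero    zero    (suc q) = refl
mℕ-convolution zero    (suc p) q       = trans (ℚₚ.+-identityʳ _) (ℚₚ.*-zeroˡ (mℕ 0 q))
mℕ-convolution (suc n) zero    q       =
  trans (cong₂ ℚ._+_ (ℚₚ.*-identityˡ (mℕ (suc n) q))
                     (sumTo-zero (suc n) (λ x _ → ℚₚ.*-zeroˡ (mℕ (n ∸ x) q))))
        (ℚₚ.+-identityʳ _)
mℕ-convolution (suc n) (suc p) q =
  +-cancelʳ (mℕ n (suc p + q)) (convolution (suc p) q (suc n)) (mℕ (suc n) (suc p + q)) (begin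
  convolution (suc p) q (suc n) ℚ.+ mℕ n (suc p + q)
    ≡⟨ cong (convolution (suc p) q (suc n) ℚ.+_) (sym (mℕ-convolution n (suc p) q)) ⟩
  convolution (suc p) q (suc n) ℚ.+ convolution (suc p) q n
    ≡⟨ convolution-pascal p q n ⟩
  convolution p q n
    ≡⟨ mℕ-convolution n p q ⟩
  mℕ n (p + q)
    ≡⟨ sym (mℕ-pascal n (p + q)) ⟩
  mℕ n (suc p + q) ℚ.+ mℕ (suc n) (suc p + q)
    ≡⟨ ℚₚ.+-comm (mℕ n (suc p + q)) (mℕ (suc n) (suc p + q)) ⟩
  mℕ (suc n) (suc p + q) ℚ.+ mℕ n (suc p + q) ∎)

convolution-dropHead : ∀ n p q → sumTo n (λ x → mℕ (suc x) (suc p) * mℕ (n ∸ suc x) q)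
                                 ≡ convolution (suc p) q n
convolution-dropHead n p q =
  sym (trans (cong (ℚ._+ sumTo n tail) (ℚₚ.*-zeroˡ (mℕ n q))) (ℚₚ.+-identityˡ (sumTo n tail)))
  where
  tail : ℕ → ℚ
  tail x = mℕ (suc x) (suc p) * mℕ (n ∸ suc x) q

compositionSum-mVec : ∀ s (b : Vec ℕ s) → All (1 ≤_) b → ∀ n →
                      compositionSum s n (λ α → mVec α b) ≡ mℕ n ∣ b ∣ᵥ
compositionSum-mVec zero    []      []            zero    = refl
compositionSum-mVec zero    []      []            (suc n) = refl
compositionSum-mVec (suc s) (suc p ∷ b) (s≤s _ ∷ b≥1) n = begin
  sumTo n (λ x → compositionSum s (n ∸ suc x) (λ α → mVec (suc x ∷ α) (suc p ∷ b)))
    ≡⟨ sumTo-cong-≗ n (λ x → trans (compositionSum-cong s (n ∸ suc x) (λ α → mVec-∷ x p α b))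
         (trans (*-distribˡ-compositionSum s (n ∸ suc x) (mℕ (suc x) (suc p)) (λ α → mVec α b))
                (cong (mℕ (suc x) (suc p) *_) (compositionSum-mVec s b b≥1 (n ∸ suc x))))) ⟩
  sumTo n (λ x → mℕ (suc x) (suc p) * mℕ (n ∸ suc x) ∣ b ∣ᵥ)
    ≡⟨ convolution-dropHead n p ∣ b ∣ᵥ ⟩
  convolution (suc p) ∣ b ∣ᵥ n
    ≡⟨ mℕ-convolution n (suc p) ∣ b ∣ᵥ ⟩
  mℕ n (suc p + ∣ b ∣ᵥ) ∎

+m-+n≡+[m∸n] : ∀ {m n} → n ≤ m → + m - + n ≡ + (m ∸ n)
+m-+n≡+[m∸n] {m} {n} n≤m = trans (ℤₚ.m-n≡m⊖n m n) (ℤₚ.⊖-≥ n≤m)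

-- When a leading part misses the threshold, w ∘ ind on x ∷ xs becomes raise w ∘ ind on xs:
-- positive indices shift by one, while ind = 0 (threshold never reached) stays 0.
raise : (ℕ → ℚ) → ℕ → ℚ
raise w zero    = w zero
raise w (suc j) = w (suc (suc j))

ind-∷-reached : ∀ {t x} xs → t ≤ x → ind (+ t) (x ∷ xs) ≡ 1
ind-∷-reached {t} {x} xs t≤x with + t ℤ.≤? + x
... | yes _   = refl
... | no  t≰x = contradiction (ℤ.+≤+ t≤x) t≰x

ind-∷-unreached : ∀ (w : ℕ → ℚ) {t x} xs → x < t →
                  w (ind (+ t) (x ∷ xs)) ≡ raise w (ind (+ (t ∸ x)) xs)
ind-∷-unreached w {t} {x} xs x<t with + t ℤ.≤? + x
... | yes t≤x = contradiction (ℤₚ.drop‿+≤+ t≤x) (ℕₚ.<⇒≱ x<t)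
... | no  _ rewrite +m-+n≡+[m∸n] (ℕₚ.<⇒≤ x<t) with ind (+ (t ∸ x)) xs
...   | zero  = refl
...   | suc j = refl

thresholdSum : ∀ {s} → Vec ℕ s → (n t : ℕ) → (ℕ → ℚ) → ℚ
thresholdSum {s} b n t w = compositionSum s n (λ α → mVec α b * w (ind (+ t) (toList α)))

overshootSum : (p q u k : ℕ) → ℚ
overshootSum p q u k = sumTo (suc k) (λ j → mℕ (suc u + j) p * mℕ (k ∸ j) q)

thresholdSum-∷ : ∀ {s} p (b : Vec ℕ s) → All (1 ≤_) b → (w : ℕ → ℚ) → ∀ u k →
                 thresholdSum (suc p ∷ b) (suc u + k) (suc u) w
                 ≡ sumTo u (λ x → mℕ (suc x) (suc p)
                                  * thresholdSum b (suc (u ∸ suc x) + k) (suc (u ∸ suc x)) (raise w))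
                   ℚ.+ w 1 * overshootSum (suc p) ∣ b ∣ᵥ u k
thresholdSum-∷ {s} p b b≥1 w u k = begin
  sumTo (suc u + k) g
    ≡⟨ cong (λ n → sumTo n g) (sym (ℕₚ.+-suc u k)) ⟩
  sumTo (u + suc k) g
    ≡⟨ sumTo-+ u (suc k) g ⟩
  sumTo u g ℚ.+ sumTo (suc k) (λ j → g (u + j))
    ≡⟨ cong₂ ℚ._+_ (sumTo-cong u unreached)
                   (trans (sumTo-cong-≗ (suc k) reached) (*-distribˡ-sumTo (suc k) (w 1) overshoot)) ⟩
  sumTo u (λ x → mℕ (suc x) (suc p) * thresholdSum b (suc (u ∸ suc x) + k) (suc (u ∸ suc x)) (raise w))
    ℚ.+ w 1 * overshootSum (suc p) ∣ b ∣ᵥ u k ∎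
  where
  g : ℕ → ℚ
  g x = compositionSum s (suc u + k ∸ suc x)
          (λ α → mVec (suc x ∷ α) (suc p ∷ b) * w (ind (+ suc u) (suc x ∷ toList α)))

  unreached : ∀ x → x < u → g x ≡ mℕ (suc x) (suc p)
                                   * thresholdSum b (suc (u ∸ suc x) + k) (suc (u ∸ suc x)) (raise w)
  unreached x x<u = begin
    g x
      ≡⟨ compositionSum-cong s _ (λ α → trans
           (cong₂ _*_ (mVec-∷ x p α b)
                      (trans (ind-∷-unreached w (toList α) (s≤s x<u))
                             (cong (λ t → raise w (ind (+ t) (toList α))) u∸x≡1+[u∸1+x])))
           (ℚₚ.*-assoc (mℕ (suc x) (suc p)) (mVec α b) _)) ⟩
    compositionSum s (suc u + k ∸ suc x)
      (λ α → mℕ (suc x) (suc p) * (mVec α b * raise w (ind (+ suc (u ∸ suc x)) (toList α))))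
      ≡⟨ *-distribˡ-compositionSum s _ (mℕ (suc x) (suc p)) _ ⟩
    mℕ (suc x) (suc p) * thresholdSum b (suc u + k ∸ suc x) (suc (u ∸ suc x)) (raise w)
      ≡⟨ cong (λ n → mℕ (suc x) (suc p) * thresholdSum b n (suc (u ∸ suc x)) (raise w))
              (trans (ℕₚ.+-∸-comm k (ℕₚ.<⇒≤ x<u)) (cong (_+ k) u∸x≡1+[u∸1+x])) ⟩
    mℕ (suc x) (suc p) * thresholdSum b (suc (u ∸ suc x) + k) (suc (u ∸ suc x)) (raise w) ∎
    where
    u∸x≡1+[u∸1+x] : u ∸ x ≡ suc (u ∸ suc x)
    u∸x≡1+[u∸1+x] = ℕₚ.+-∸-assoc 1 x<u

  overshoot : ℕ → ℚ
  overshoot j = mℕ (suc u + j) (suc p) * mℕ (k ∸ j) ∣ b ∣ᵥ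

  reached : ∀ j → g (u + j) ≡ w 1 * overshoot j
  reached j = begin
    g (u + j)
      ≡⟨ compositionSum-cong s _ (λ α → trans
           (cong₂ _*_ (mVec-∷ (u + j) p α b)
                      (cong w (ind-∷-reached (toList α) (s≤s (ℕₚ.m≤m+n u j)))))
           (solve 3 (λ m v c → (m :* v) :* c := (c :* m) :* v) refl
                  (mℕ (suc u + j) (suc p)) (mVec α b) (w 1))) ⟩
    compositionSum s (u + k ∸ (u + j)) (λ α → (w 1 * mℕ (suc u + j) (suc p)) * mVec α b)
      ≡⟨ *-distribˡ-compositionSum s _ (w 1 * mℕ (suc u + j) (suc p)) (λ α → mVec α b) ⟩
    (w 1 * mℕ (suc u + j) (suc p)) * compositionSum s (u + k ∸ (u + j)) (λ α → mVec α b)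
      ≡⟨ cong ((w 1 * mℕ (suc u + j) (suc p)) *_)
              (trans (cong (λ n → compositionSum s n (λ α → mVec α b))
                           (ℕₚ.[m+n]∸[m+o]≡n∸o u k j))
                     (compositionSum-mVec s b b≥1 (k ∸ j))) ⟩
    (w 1 * mℕ (suc u + j) (suc p)) * mℕ (k ∸ j) ∣ b ∣ᵥ
      ≡⟨ ℚₚ.*-assoc (w 1) (mℕ (suc u + j) (suc p)) (mℕ (k ∸ j) ∣ b ∣ᵥ) ⟩
    w 1 * (mℕ (suc u + j) (suc p) * mℕ (k ∸ j) ∣ b ∣ᵥ) ∎

overshootSum-pascalʳ : ∀ p q u k → overshootSum p (suc q) u k ℚ.+ overshootSum p (suc q) u (suc k)
                                   ≡ overshootSum p q u k
overshootSum-pascalʳ p q u k = begin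
  overshootSum p (suc q) u k ℚ.+ overshootSum p (suc q) u (suc k)
    ≡⟨ cong (overshootSum p (suc q) u k ℚ.+_)
            (trans (sumTo-dropLast (suc k) (λ j → f j * mℕ (suc k ∸ j) (suc q)) last≡0)
                   (sumTo-cong (suc k) (λ j j<1+k → cong (λ n → f j * mℕ n (suc q))
                                                         (ℕₚ.+-∸-assoc 1 (ℕₚ.≤-pred j<1+k))))) ⟩
  sumTo (suc k) lower ℚ.+ sumTo (suc k) upper
    ≡⟨ sym (sumTo-distrib-+ (suc k) lower upper) ⟩
  sumTo (suc k) (λ j → lower j ℚ.+ upper j)
    ≡⟨ sumTo-cong-≗ (suc k) (λ j →
         trans (sym (ℚₚ.*-distribˡ-+ (f j) (mℕ (k ∸ j) (suc q)) (mℕ (suc (k ∸ j)) (suc q))))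
               (cong (f j *_) (mℕ-pascal (k ∸ j) q))) ⟩
  overshootSum p q u k ∎
  where
  f lower upper : ℕ → ℚ
  f j = mℕ (suc u + j) p
  lower j = f j * mℕ (k ∸ j) (suc q)
  upper j = f j * mℕ (suc (k ∸ j)) (suc q)
  last≡0 : f (suc k) * mℕ (suc k ∸ suc k) (suc q) ≡ 0ℚ
  last≡0 = trans (cong (λ n → f (suc k) * mℕ n (suc q)) (ℕₚ.n∸n≡0 k)) (ℚₚ.*-zeroʳ (f (suc k)))

overshootSum-zeroʳ : ∀ p u k → overshootSum p 0 u k ≡ mℕ (suc u + k) p
overshootSum-zeroʳ p u k = begin
  overshootSum p 0 u k
    ≡⟨ sumTo-last k (λ j → f j * mℕ (k ∸ j) 0) ⟩
  sumTo k (λ j → f j * mℕ (k ∸ j) 0) ℚ.+ f k * mℕ (k ∸ k) 0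
    ≡⟨ cong₂ ℚ._+_
         (sumTo-zero k (λ j j<k → trans (cong (λ n → f j * mℕ n 0) (ℕₚ.+-∸-assoc 1 j<k))
                                        (ℚₚ.*-zeroʳ (f j))))
         (trans (cong (λ n → f k * mℕ n 0) (ℕₚ.n∸n≡0 k)) (ℚₚ.*-identityʳ (f k))) ⟩
  0ℚ ℚ.+ f k
    ≡⟨ ℚₚ.+-identityˡ (f k) ⟩
  f k ∎
  where
  f : ℕ → ℚ
  f j = mℕ (suc u + j) p

overshootSum-pascalˡ : ∀ p u k → overshootSum (suc p) 0 u k ℚ.+ overshootSum (suc p) 0 u (suc k)
                                 ≡ overshootSum p 0 u k
overshootSum-pascalˡ p u k = begin
  overshootSum (suc p) 0 u k ℚ.+ overshootSum (suc p) 0 u (suc k)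
    ≡⟨ cong₂ ℚ._+_ (overshootSum-zeroʳ (suc p) u k)
                   (trans (overshootSum-zeroʳ (suc p) u (suc k))
                          (cong (λ n → mℕ n (suc p)) (ℕₚ.+-suc (suc u) k))) ⟩
  mℕ (suc u + k) (suc p) ℚ.+ mℕ (suc (suc u + k)) (suc p)
    ≡⟨ mℕ-pascal (suc u + k) p ⟩
  mℕ (suc u + k) p
    ≡⟨ sym (overshootSum-zeroʳ p u k) ⟩
  overshootSum p 0 u k ∎

shiftSum-overshootSum-≤ : ∀ D p q u → q ≤ D →
                          shiftSum D (overshootSum p q u) 0 ≡ mℕ (suc u) (p + q ∸ D)
shiftSum-overshootSum-≤ zero    p       zero    u z≤n =
  trans (overshootSum-zeroʳ p u 0) (cong₂ mℕ (ℕₚ.+-identityʳ (suc u)) (sym (ℕₚ.+-identityʳ p)))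
shiftSum-overshootSum-≤ (suc D) p       (suc q) u (s≤s q≤D) =
  trans (shiftSum-suc D (overshootSum-pascalʳ p q u) 0)
        (trans (shiftSum-overshootSum-≤ D p q u q≤D)
               (cong (λ n → mℕ (suc u) (n ∸ suc D)) (sym (ℕₚ.+-suc p q))))
shiftSum-overshootSum-≤ (suc D) (suc p) zero    u z≤n =
  trans (shiftSum-suc D (overshootSum-pascalˡ p u) 0) (shiftSum-overshootSum-≤ D p 0 u z≤n)
shiftSum-overshootSum-≤ (suc D) zero    zero    u z≤n =
  trans (shiftSum-suc D {G = λ _ → 0ℚ}
                      (λ k → cong₂ ℚ._+_ (overshootSum-zeroʳ 0 u k)
                                         (overshootSum-zeroʳ 0 u (suc k))) 0)
        (shiftSum-zero D 0)

shiftSum-overshootSum-> : ∀ D p q u → D < q → shiftSum D (overshootSum p q u) 0 ≡ 0ℚ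
shiftSum-overshootSum-> zero    p (suc q) u _ =
  trans (ℚₚ.+-identityʳ (mℕ (suc u + 0) p * 0ℚ)) (ℚₚ.*-zeroʳ (mℕ (suc u + 0) p))
shiftSum-overshootSum-> (suc D) p (suc q) u (s≤s D<q) =
  trans (shiftSum-suc D (overshootSum-pascalʳ p q u) 0) (shiftSum-overshootSum-> D p q u D<q)

convolution-tail : ∀ p q u → sumTo u (λ x → mℕ (suc x) (suc p) * mℕ (suc (u ∸ suc x)) (suc q))
                             ≡ mℕ (suc u) (suc p + suc q)
convolution-tail p q u = begin
  sumTo u (λ x → mℕ (suc x) (suc p) * mℕ (suc (u ∸ suc x)) (suc q))
    ≡⟨ sumTo-cong u (λ x x<u → cong (λ n → mℕ (suc x) (suc p) * mℕ n (suc q))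
                                    (sym (ℕₚ.+-∸-assoc 1 x<u))) ⟩
  sumTo u term
    ≡⟨ sym (sumTo-dropLast u term last≡0) ⟩
  sumTo (suc u) term
    ≡⟨ convolution-dropHead (suc u) p (suc q) ⟩
  convolution (suc p) (suc q) (suc u)
    ≡⟨ mℕ-convolution (suc u) (suc p) (suc q) ⟩
  mℕ (suc u) (suc p + suc q) ∎
  where
  term : ℕ → ℚ
  term x = mℕ (suc x) (suc p) * mℕ (u ∸ x) (suc q)
  last≡0 : term u ≡ 0ℚ
  last≡0 = trans (cong (λ n → mℕ (suc u) (suc p) * mℕ n (suc q)) (ℕₚ.n∸n≡0 u))
                 (ℚₚ.*-zeroʳ (mℕ (suc u) (suc p)))

thresholdTerm : (a n : ℕ) → (ℕ → ℚ) → List ℕ → ℚ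
thresholdTerm a n w xs = mℕ a n * w (ind (+ n) xs)

thresholdTerm-zero : ∀ a w xs → thresholdTerm (suc a) 0 w xs ≡ 0ℚ
thresholdTerm-zero a w xs = ℚₚ.*-zeroˡ (w (ind (+ 0) xs))

thresholdStep-unreached : ∀ p q u (w : ℕ → ℚ) xs →
  sumTo u (λ x → mℕ (suc x) (suc p) * thresholdTerm (suc (u ∸ suc x)) (suc q) (raise w) xs)
  ≡ thresholdTerm (suc u) (suc p + suc q) w (suc p ∷ xs)
thresholdStep-unreached p q u w xs = begin
  sumTo u (λ x → mℕ (suc x) (suc p) * (mℕ (suc (u ∸ suc x)) (suc q) * c))
    ≡⟨ sumTo-cong-≗ u (λ x → solve 3 (λ a b c → a :* (b :* c) := c :* (a :* b)) refl
                               (mℕ (suc x) (suc p)) (mℕ (suc (u ∸ suc x)) (suc q)) c) ⟩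
  sumTo u (λ x → c * (mℕ (suc x) (suc p) * mℕ (suc (u ∸ suc x)) (suc q)))
    ≡⟨ *-distribˡ-sumTo u c _ ⟩
  c * sumTo u (λ x → mℕ (suc x) (suc p) * mℕ (suc (u ∸ suc x)) (suc q))
    ≡⟨ trans (cong (c *_) (convolution-tail p q u)) (ℚₚ.*-comm c _) ⟩
  mℕ (suc u) (suc p + suc q) * c
    ≡⟨ cong (mℕ (suc u) (suc p + suc q) *_) (sym (trans
         (ind-∷-unreached w xs (ℕₚ.m<m+n (suc p) (s≤s z≤n)))
         (cong (λ n → raise w (ind (+ n) xs)) (ℕₚ.m+n∸m≡n (suc p) (suc q))))) ⟩
  thresholdTerm (suc u) (suc p + suc q) w (suc p ∷ xs) ∎
  where
  c = raise w (ind (+ suc q) xs)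

-- The right-hand side of thresholdSum-∷ after applying (1+E)ᴰ and the induction hypothesis.
thresholdStep : ∀ p B u D (w : ℕ → ℚ) xs →
  sumTo u (λ x → mℕ (suc x) (suc p) * thresholdTerm (suc (u ∸ suc x)) (B ∸ D) (raise w) xs)
    ℚ.+ w 1 * shiftSum D (overshootSum (suc p) B u) 0
  ≡ thresholdTerm (suc u) (suc p + B ∸ D) w (suc p ∷ xs)
thresholdStep p B u D w xs with B ℕ.≤? D
... | yes B≤D = begin
  sumTo u (λ x → mℕ (suc x) (suc p) * thresholdTerm (suc (u ∸ suc x)) (B ∸ D) (raise w) xs)
    ℚ.+ w 1 * shiftSum D (overshootSum (suc p) B u) 0
    ≡⟨ cong₂ ℚ._+_ (sumTo-zero u (λ x _ → unreached-vanishes x))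
                   (cong (w 1 *_) (shiftSum-overshootSum-≤ D (suc p) B u B≤D)) ⟩
  0ℚ ℚ.+ w 1 * mℕ (suc u) (suc p + B ∸ D)
    ≡⟨ trans (ℚₚ.+-identityˡ _) (ℚₚ.*-comm (w 1) _) ⟩
  mℕ (suc u) (suc p + B ∸ D) * w 1
    ≡⟨ cong (λ i → mℕ (suc u) (suc p + B ∸ D) * w i) (sym (ind-∷-reached xs reached)) ⟩
  thresholdTerm (suc u) (suc p + B ∸ D) w (suc p ∷ xs) ∎
  where
  unreached-vanishes : ∀ x → mℕ (suc x) (suc p) * thresholdTerm (suc (u ∸ suc x)) (B ∸ D) (raise w) xs
                             ≡ 0ℚ
  unreached-vanishes x =
    trans (cong (λ n → mℕ (suc x) (suc p) * thresholdTerm (suc (u ∸ suc x)) n (raise w) xs)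
                (ℕₚ.m≤n⇒m∸n≡0 B≤D))
          (trans (cong (mℕ (suc x) (suc p) *_) (thresholdTerm-zero (u ∸ suc x) (raise w) xs))
                 (ℚₚ.*-zeroʳ (mℕ (suc x) (suc p))))
  reached : suc p + B ∸ D ≤ suc p
  reached = ℕₚ.≤-trans (ℕₚ.∸-monoˡ-≤ D (ℕₚ.+-monoʳ-≤ (suc p) B≤D))
                       (ℕₚ.≤-reflexive (ℕₚ.m+n∸n≡m (suc p) D))
... | no B≰D = begin
  sumTo u (λ x → mℕ (suc x) (suc p) * thresholdTerm (suc (u ∸ suc x)) (B ∸ D) (raise w) xs)
    ℚ.+ w 1 * shiftSum D (overshootSum (suc p) B u) 0
    ≡⟨ cong₂ ℚ._+_
         (cong (λ n → sumTo u (λ x → mℕ (suc x) (suc p) * thresholdTerm (suc (u ∸ suc x)) n (raise w) xs))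
               B∸D≡1+q)
         (trans (cong (w 1 *_) (shiftSum-overshootSum-> D (suc p) B u D<B)) (ℚₚ.*-zeroʳ (w 1))) ⟩
  sumTo u (λ x → mℕ (suc x) (suc p) * thresholdTerm (suc (u ∸ suc x)) (suc q) (raise w) xs) ℚ.+ 0ℚ
    ≡⟨ trans (ℚₚ.+-identityʳ _) (thresholdStep-unreached p q u w xs) ⟩
  thresholdTerm (suc u) (suc p + suc q) w (suc p ∷ xs)
    ≡⟨ cong (λ n → thresholdTerm (suc u) n w (suc p ∷ xs)) (sym 1+p+B∸D≡1+p+1+q) ⟩
  thresholdTerm (suc u) (suc p + B ∸ D) w (suc p ∷ xs) ∎
  where
  D<B : D < B
  D<B = ℕₚ.≰⇒> B≰D
  q = B ∸ suc D
  B∸D≡1+q : B ∸ D ≡ suc q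
  B∸D≡1+q = ℕₚ.+-∸-assoc 1 D<B
  1+p+B∸D≡1+p+1+q : suc p + B ∸ D ≡ suc p + suc q
  1+p+B∸D≡1+p+1+q = trans (ℕₚ.+-∸-assoc (suc p) (ℕₚ.<⇒≤ D<B)) (cong (λ n → suc p + n) B∸D≡1+q)

shiftSum-thresholdSum : ∀ {s} (b : Vec ℕ s) → All (1 ≤_) b → (w : ℕ → ℚ) → ∀ u D →
                        shiftSum D (λ k → thresholdSum b (suc u + k) (suc u) w) 0
                        ≡ thresholdTerm (suc u) (∣ b ∣ᵥ ∸ D) w (toList b)
shiftSum-thresholdSum [] [] w u D =
  trans (shiftSum-zero D 0)
        (sym (trans (cong (λ n → thresholdTerm (suc u) n w []) (ℕₚ.0∸n≡0 D))
                    (thresholdTerm-zero u w [])))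
shiftSum-thresholdSum (suc p ∷ b) (s≤s _ ∷ b≥1) w u D = begin
  shiftSum D (λ k → thresholdSum (suc p ∷ b) (suc u + k) (suc u) w) 0
    ≡⟨ shiftSum-cong D (thresholdSum-∷ p b b≥1 w u) 0 ⟩
  shiftSum D (λ k → sumTo u (λ x → F x k) ℚ.+ overshoot k) 0
    ≡⟨ shiftSum-distrib-+ D (λ k → sumTo u (λ x → F x k)) overshoot 0 ⟩
  shiftSum D (λ k → sumTo u (λ x → F x k)) 0 ℚ.+ shiftSum D overshoot 0
    ≡⟨ cong₂ ℚ._+_ (trans (shiftSum-sumTo D u F 0) (sumTo-cong-≗ u unreached))
                   (*-distribˡ-shiftSum D (w 1) (overshootSum (suc p) B u) 0) ⟩
  sumTo u (λ x → mℕ (suc x) (suc p) * thresholdTerm (suc (u ∸ suc x)) (B ∸ D) (raise w) (toList b))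
    ℚ.+ w 1 * shiftSum D (overshootSum (suc p) B u) 0
    ≡⟨ thresholdStep p B u D w (toList b) ⟩
  thresholdTerm (suc u) (suc p + B ∸ D) w (suc p ∷ toList b) ∎
  where
  B = ∣ b ∣ᵥ
  F : ℕ → ℕ → ℚ
  F x k = mℕ (suc x) (suc p) * thresholdSum b (suc (u ∸ suc x) + k) (suc (u ∸ suc x)) (raise w)
  overshoot : ℕ → ℚ
  overshoot k = w 1 * overshootSum (suc p) B u k
  unreached : ∀ x → shiftSum D (F x) 0
                    ≡ mℕ (suc x) (suc p) * thresholdTerm (suc (u ∸ suc x)) (B ∸ D) (raise w) (toList b)
  unreached x = trans (*-distribˡ-shiftSum D (mℕ (suc x) (suc p)) _ 0)
                      (cong (mℕ (suc x) (suc p) *_) (shiftSum-thresholdSum b b≥1 (raise w) (u ∸ suc x) D))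

B₁-zero : ∀ m → B₁ m 0 ≡ 0ℚ
B₁-zero m = ℚₚ.*-zeroʳ ((+ 1 ℚ./ (m ℕ.!)) {{m ℕₚ.!≢0}})

μ≡B₁∘ind : ∀ t xs → μ t xs ≡ B₁ (length xs) (ind t xs)
μ≡B₁∘ind t xs with ind t xs
... | zero  = sym (B₁-zero (length xs))
... | suc j = refl

Σℚ-compositions-μ : ∀ s (b : Vec ℕ s) t n →
                    Σℚ (map (λ α → mVec α b * μ (+ t) (toList α)) (compositions s n))
                    ≡ thresholdSum b n t (B₁ s)
Σℚ-compositions-μ s b t n =
  trans (Σℚ-compositions s n _) (compositionSum-cong s n (λ α → cong (mVec α b *_) (μ≡B₁ α)))
  where
  μ≡B₁ : ∀ (α : Vec ℕ s) → μ (+ t) (toList α) ≡ B₁ s (ind (+ t) (toList α))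
  μ≡B₁ α = trans (μ≡B₁∘ind (+ t) (toList α))
                 (cong (λ m → B₁ m (ind (+ t) (toList α))) (length-toList α))

mScalar-neg : ∀ k n → mScalar k (ℤ.- + n) ≡ 0ℚ
mScalar-neg k zero    = ℚₚ.*-zeroʳ (signℤ (+ k ℤ.+ ℤ.- + 0))
mScalar-neg k (suc n) = ℚₚ.*-zeroʳ (signℤ (+ k ℤ.+ ℤ.- + suc n))

mScalar≡mℕ : ∀ k n → mScalar (suc k) (+ n) ≡ mℕ (suc k) n
mScalar≡mℕ k zero    = ℚₚ.*-zeroʳ (signℤ (+ suc k ℤ.+ + 0))
mScalar≡mℕ k (suc n) =
  trans (cong (λ m → - signℕ m * ℕ→ℚ (k C n)) (ℕₚ.+-suc k n))
        (cong (_* ℕ→ℚ (k C n)) (neg-involutive (signℕ (k + n))))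

-- When B ≤ D both sides vanish, so the truncated difference B ∸ D may replace B - D.
mScalar-μ-truncate : ∀ u B D xs → mScalar (suc u) (+ B - + D) * μ (+ B - + D) xs
                                  ≡ thresholdTerm (suc u) (B ∸ D) (B₁ (length xs)) xs
mScalar-μ-truncate u B D xs with B ℕ.≤? D
... | yes B≤D = begin
  mScalar (suc u) (+ B - + D) * μ (+ B - + D) xs
    ≡⟨ cong (λ l → mScalar (suc u) l * μ l xs) (trans (ℤₚ.m-n≡m⊖n B D) (ℤₚ.⊖-≤ B≤D)) ⟩
  mScalar (suc u) (ℤ.- + (D ∸ B)) * μ (ℤ.- + (D ∸ B)) xs
    ≡⟨ cong (_* μ (ℤ.- + (D ∸ B)) xs) (mScalar-neg (suc u) (D ∸ B)) ⟩
  0ℚ * μ (ℤ.- + (D ∸ B)) xs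
    ≡⟨ ℚₚ.*-zeroˡ (μ (ℤ.- + (D ∸ B)) xs) ⟩
  0ℚ
    ≡⟨ sym (thresholdTerm-zero u (B₁ (length xs)) xs) ⟩
  thresholdTerm (suc u) 0 (B₁ (length xs)) xs
    ≡⟨ cong (λ n → thresholdTerm (suc u) n (B₁ (length xs)) xs) (sym (ℕₚ.m≤n⇒m∸n≡0 B≤D)) ⟩
  thresholdTerm (suc u) (B ∸ D) (B₁ (length xs)) xs ∎
... | no B≰D rewrite +m-+n≡+[m∸n] (ℕₚ.<⇒≤ (ℕₚ.≰⇒> B≰D)) =
  cong₂ _*_ (mScalar≡mℕ u (B ∸ D)) (μ≡B₁∘ind (+ (B ∸ D)) xs)

proposition5p4 : (l : ℕ) → 1 ≤ l → (d : Vec ℕ l) → (∀ i → 1 ≤ lookup d i)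
    → (a : ℕ) → 1 ≤ a
    → (s : ℕ) → (b : Vec ℕ s) → (∀ j → 1 ≤ lookup b j)
    → Σℚ (map (λ r → signℕ (∣ d ∣ᵥ + ∣ r ∣ᵥ) * mVec (d +𝟏) (r +𝟏)
                 * Σℚ (map (λ α → mVec α b * μ (+ a) (toList α))
                           (compositions s (a + (∣ d ∣ᵥ ∸ ∣ r ∣ᵥ)))))
              (box d))
      ≡ mScalar a (+ ∣ b ∣ᵥ - + ∣ d ∣ᵥ) * μ (+ ∣ b ∣ᵥ - + ∣ d ∣ᵥ) (toList b)
proposition5p4 l _ d _ (suc u) _ s b b≥1 = begin
  Σℚ (map (λ r → signℕ (D + ∣ r ∣ᵥ) * mVec (d +𝟏) (r +𝟏) * G (suc u + (D ∸ ∣ r ∣ᵥ)))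
          (box d))
    ≡⟨ Σℚ-map-cong (box d) (λ r →
         cong₂ _*_ (signed-mVec-+𝟏 d r) (Σℚ-compositions-μ s b (suc u) _)) ⟩
  Σℚ (map (λ r → binomials d r * T (suc u + (D ∸ ∣ r ∣ᵥ))) (box d))
    ≡⟨ Σℚ-box-binomials d T (suc u) ⟩
  shiftSum D T (suc u)
    ≡⟨ cong (shiftSum D T) (sym (ℕₚ.+-identityʳ (suc u))) ⟩
  shiftSum D T (suc u + 0)
    ≡⟨ sym (shiftSum-translate D T (suc u) 0) ⟩
  shiftSum D (λ k → T (suc u + k)) 0
    ≡⟨ shiftSum-thresholdSum b (lookup⁻ b≥1) (B₁ s) u D ⟩
  thresholdTerm (suc u) (∣ b ∣ᵥ ∸ D) (B₁ s) (toList b)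
    ≡⟨ cong (λ m → thresholdTerm (suc u) (∣ b ∣ᵥ ∸ D) (B₁ m) (toList b))
            (sym (length-toList b)) ⟩
  thresholdTerm (suc u) (∣ b ∣ᵥ ∸ D) (B₁ (length (toList b))) (toList b)
    ≡⟨ sym (mScalar-μ-truncate u ∣ b ∣ᵥ D (toList b)) ⟩
  mScalar (suc u) (+ ∣ b ∣ᵥ - + D) * μ (+ ∣ b ∣ᵥ - + D) (toList b) ∎
  where
  D = ∣ d ∣ᵥ
  G T : ℕ → ℚ
  G n = Σℚ (map (λ α → mVec α b * μ (+ suc u) (toList α)) (compositions s n))
  T n = thresholdSum b n (suc u) (B₁ s)
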